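{- Let $m_1,\dots,m_t$ be positive integers and $a_1,\dots,a_t$ integers such that $\bigcup_{i=1}^t\{n\in\mathbb{Z} : n\equiv a_i\pmod{m_i}\}=\mathbb{Z}$. If $p$ is a prime and the set $\{a_i : p\mid m_i\}$ does not contain a complete residue system modulo $p$, then the sequence $\{m_i : 1\le i\le t,\ p\nmid m_i\}$ is coverable. In particular, if $\{m_1,\dots,m_t\}$ is a coverable sequence and $|\{i : p\mid m_i\}|<p$, then $\{m_i : p\nmid m_i\}$ is also a coverable sequence.
   Context: A finite sequence $\{m_1,\dots,m_t\}$ of positive integers is called coverable if there exist integers $a_1,\dots,a_t$ such that every integer $n$ satisfies $n\equiv a_i\pmod{m_i}$ for some $i$. -}

module Defs where

open import Data.Nat using (ℕ; _<_)
open import Data.Nat.Divisibility using (_∣_; _∣?_)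
open import Data.Integer as ℤ using (ℤ; +_; _-_)
import Data.Integer.Divisibility as ℤD
open import Data.List using (List; length; lookup; filter; map)
open import Data.List.Relation.Unary.All using (All)
open import Data.Fin using (Fin)
open import Data.Product using (Σ; ∃; _×_; proj₁; proj₂)
open import Relation.Nullary using (¬_; ¬?)
open import Relation.Unary using (∁)

_≡_[mod_] : ℤ → ℤ → ℕ → Set
n ≡ a [mod m ] = (+ m) ℤD.∣ (n - a)

AllPositive : List ℕ → Set
AllPositive ms = All (λ m → 0 < m) ms

Coverable : List ℕ → Set
Coverable ms = Σ (Fin (length ms) → ℤ) λ a →
  (n : ℤ) → ∃ λ i → n ≡ a i [mod lookup ms i ]

CoversZ : List (ℕ × ℤ) → Set
CoversZ sys = (n : ℤ) → ∃ λ i →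
  n ≡ proj₂ (lookup sys i) [mod proj₁ (lookup sys i) ]

moduli : List (ℕ × ℤ) → List ℕ
moduli sys = map proj₁ sys

-- { m_i : p ∤ m_i } (as a subsequence, in order, with multiplicity)
coprimePart : ℕ → List ℕ → List ℕ
coprimePart p ms = filter (λ m → ¬? (p ∣? m)) ms

ContainsCRS : ℕ → List (ℕ × ℤ) → Set
ContainsCRS p sys = (r : ℤ) → ∃ λ i →
  (p ∣ proj₁ (lookup sys i)) × (proj₂ (lookup sys i) ≡ r [mod p ])

countDiv : ℕ → List ℕ → ℕ
countDiv p ms = length (filter (p ∣?_) ms)

{-# OPTIONS --safe #-}
-- Pick a residue r modulo p attained by no a_i with p ∣ m_i. Let N be the product
-- of the moduli prime to p and u an inverse of N modulo p. For any x, the integer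
-- y = x + N u (r − x) is ≡ r (mod p) and ≡ x modulo every m_i prime to p. The class
-- covering y cannot have p ∣ m_i, since then a_i ≡ y ≡ r (mod p); so it is a class
-- with p ∤ m_i, and it covers x as well. For the second claim, fewer than p classes
-- with p ∣ m_i cannot attain all p residues modulo p.
module Submission where

open import Defs
open import Data.Nat using (ℕ; _<_)
open import Data.Nat.Primality using (Prime)
open import Data.Integer using (ℤ)
open import Data.List using (List)
open import Data.Product using (_×_)
open import Relation.Nullary using (¬_)

open import Data.Nat as ℕ using (_≤_; _⊔_)
import Data.Nat.Properties as ℕ
open import Data.Nat.Divisibility using (_∣_; _∣?_; ∣-trans; ∣1⇒≡1; n∣m⇒m%n≡0)
open import Data.Nat.DivMod using (m<n⇒m%n≡m)
open import Data.Nat.Primality using (prime⇒nonZero; prime⇒irreducible; euclidsLemma; ¬prime[1])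
open import Data.Nat.Coprimality using (Coprime; coprime-Bézout)
open import Data.Nat.GCD using (module Bézout)
open import Data.Nat.ListAction using (product)
open import Data.Nat.ListAction.Properties using (∈⇒∣product)
open import Data.Integer as ℤ using (+_; _+_; _-_; -_; _*_; ∣_∣; _⊖_)
import Data.Integer.Properties as ℤ
open import Data.Integer.DivMod using (_%ℕ_; _/ℕ_; n%ℕd<d; a≡a%ℕn+[a/ℕn]*n)
import Data.Integer.Divisibility.Signed as ℤˢ
open import Data.Integer.Divisibility.Signed using (∣ᵤ⇒∣; ∣⇒∣ᵤ)
open import Data.Integer.Tactic.RingSolver using (solve-∀)
open import Data.List using ([]; _∷_; map; filter; length; lookup; tabulate)
open import Data.List.Properties using (length-map; map-tabulate; tabulate-lookup)
open import Data.List.Relation.Unary.All using (All; []; _∷_)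
import Data.List.Relation.Unary.All.Properties as All
open import Data.List.Relation.Unary.Any as Any using (Any; here; there)
open import Data.List.Relation.Unary.Any.Properties using (lookup-result; tabulate⁺)
open import Data.List.Membership.Propositional using (_∈_; find; lose)
open import Data.List.Membership.Propositional.Properties using (∈-lookup; ∈-filter⁺; ∈-map⁺)
open import Data.Fin as Fin using (Fin; zero; suc; toℕ; fromℕ<)
import Data.Fin.Properties as Fin
open import Data.Product using (∃; _,_; proj₁; proj₂)
open import Data.Sum using (inj₁; inj₂)
open import Function using (_∘_)
open import Function.Definitions using (Injective)
open import Relation.Nullary using (Dec; yes; no; ¬?; _×-dec_; contradiction)
open import Relation.Unary using (Pred; Decidable)
open import Relation.Binary.PropositionalEquality using (_≡_; refl; sym; trans; cong; subst; module ≡-Reasoning)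

private
  variable
    m p : ℕ

≡-mod⇒∣ : ∀ n a → n ≡ a [mod m ] → + m ℤˢ.∣ (n - a)
≡-mod⇒∣ {m} n a = ∣ᵤ⇒∣ {+ m} {n - a}

∣⇒≡-mod : ∀ n a → + m ℤˢ.∣ (n - a) → n ≡ a [mod m ]
∣⇒≡-mod n a = ∣⇒∣ᵤ

≡-mod-sym : ∀ n a → n ≡ a [mod m ] → a ≡ n [mod m ]
≡-mod-sym {m} n a n≡a = subst (m ∣_) (ℤ.∣i-j∣≡∣j-i∣ n a) n≡a

≡-mod-trans : ∀ n a b → n ≡ a [mod m ] → a ≡ b [mod m ] → n ≡ b [mod m ]
≡-mod-trans {m} n a b n≡a a≡b = ∣⇒≡-mod n b (subst (+ m ℤˢ.∣_) (telescope n a b)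
  (ℤˢ.∣m∣n⇒∣m+n (≡-mod⇒∣ n a n≡a) (≡-mod⇒∣ a b a≡b)))
  where
  telescope : ∀ n a b → (n - a) + (a - b) ≡ n - b
  telescope = solve-∀

_≡?_[mod_] : ∀ n a m → Dec (n ≡ a [mod m ])
n ≡? a [mod m ] = m ∣? ∣ n - a ∣

+-multiple-≡-mod : ∀ {m k} → m ∣ k → ∀ (x y : ℤ) → (x + + k * y) ≡ x [mod m ]
+-multiple-≡-mod {m} {k} m∣k x y = ∣⇒≡-mod (x + + k * y) x
  (subst (+ m ℤˢ.∣_) (sym (shift x (+ k) y)) (ℤˢ.∣m⇒∣m*n y (∣ᵤ⇒∣ {+ m} {+ k} m∣k)))
  where
  shift : ∀ x c y → (x + c * y) - x ≡ c * y
  shift = solve-∀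

unit-shift-≡-mod : ∀ (c u : ℤ) → (c * u) ≡ + 1 [mod m ] →
  ∀ (x r : ℤ) → (x + c * (u * (r - x))) ≡ r [mod m ]
unit-shift-≡-mod {m} c u cu≡1 x r = ∣⇒≡-mod (x + c * (u * (r - x))) r
  (subst (+ m ℤˢ.∣_) (sym (shift x c u r)) (ℤˢ.∣m⇒∣m*n (r - x) (≡-mod⇒∣ (c * u) (+ 1) cu≡1)))
  where
  shift : ∀ x c u r → (x + c * (u * (r - x))) - r ≡ (c * u - + 1) * (r - x)
  shift = solve-∀

≡-mod-%ℕ : ∀ r p .{{_ : ℕ.NonZero p}} → r ≡ (+ (r %ℕ p)) [mod p ]
≡-mod-%ℕ r p = ∣⇒≡-mod r (+ (r %ℕ p)) (ℤˢ.divides (r /ℕ p) (begin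
  r - + (r %ℕ p)                             ≡⟨ cong (_- + (r %ℕ p)) (a≡a%ℕn+[a/ℕn]*n r p) ⟩
  (+ (r %ℕ p) + (r /ℕ p) * + p) - + (r %ℕ p) ≡⟨ cancel (+ (r %ℕ p)) ((r /ℕ p) * + p) ⟩
  (r /ℕ p) * + p                             ∎))
  where
  open ≡-Reasoning
  cancel : ∀ s t → (s + t) - s ≡ t
  cancel = solve-∀

≡-mod-unique : ∀ {j k} → (+ j) ≡ (+ k) [mod p ] → j < p → k < p → j ≡ k
≡-mod-unique {p} {j} {k} j≡k j<p k<p = ℤ.+-injective (ℤ.i-j≡0⇒i≡j (+ j) (+ k)
  (ℤ.∣i∣≡0⇒i≡0 (trans (sym (m<n⇒m%n≡m distance<p)) (n∣m⇒m%n≡0 _ p j≡k))))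
  where
  instance
    p≢0 : ℕ.NonZero p
    p≢0 = ℕ.>-nonZero (ℕ.≤-<-trans ℕ.z≤n j<p)
  distance<p : ∣ + j - + k ∣ < p
  distance<p = begin-strict
    ∣ + j - + k ∣ ≡⟨ cong ∣_∣ (ℤ.[+m]-[+n]≡m⊖n j k) ⟩
    ∣ j ⊖ k ∣     ≤⟨ ℤ.∣m⊝n∣≤m⊔n j k ⟩
    j ⊔ k         <⟨ ℕ.⊔-lub j<p k<p ⟩
    p             ∎
    where open ℕ.≤-Reasoning

prime∤product : ∀ {ms} → Prime p → All (λ m → ¬ p ∣ m) ms → ¬ p ∣ product ms
prime∤product pp []            p∣1 = ¬prime[1] (subst Prime (∣1⇒≡1 p∣1) pp)
prime∤product pp (p∤m ∷ p∤ms) p∣m*ms with euclidsLemma _ _ pp p∣m*ms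
... | inj₁ p∣m  = p∤m p∣m
... | inj₂ p∣ms = prime∤product pp p∤ms p∣ms

prime∤⇒coprime : Prime p → ¬ p ∣ m → Coprime p m
prime∤⇒coprime pp p∤m (d∣p , d∣m) with prime⇒irreducible pp d∣p
... | inj₁ d≡1 = d≡1
... | inj₂ refl = contradiction d∣m p∤m

pos-1+*≡* : ∀ a b c d → 1 ℕ.+ a ℕ.* b ≡ c ℕ.* d → + 1 + + a * + b ≡ + c * + d
pos-1+*≡* a b c d eq = begin
  + 1 + + a * + b     ≡⟨ cong (λ t → + 1 + t) (ℤ.pos-* a b) ⟨
  + 1 + + (a ℕ.* b)   ≡⟨ ℤ.pos-+ 1 (a ℕ.* b) ⟨
  + (1 ℕ.+ a ℕ.* b)   ≡⟨ cong +_ eq ⟩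
  + (c ℕ.* d)         ≡⟨ ℤ.pos-* c d ⟩
  + c * + d           ∎
  where open ≡-Reasoning

coprime⇒inverse : Coprime p m → ∃ λ u → (+ m * u) ≡ + 1 [mod p ]
coprime⇒inverse {p} {m} coprime with coprime-Bézout coprime
... | Bézout.+- x y 1+ym≡xp = - + y , ∣⇒≡-mod (+ m * - + y) (+ 1) (ℤˢ.divides (- + x) (begin
  + m * - + y - + 1     ≡⟨ rearrange (+ m) (+ y) ⟩
  - (+ 1 + + y * + m)   ≡⟨ cong -_ (pos-1+*≡* y m x p 1+ym≡xp) ⟩
  - (+ x * + p)         ≡⟨ ℤ.neg-distribˡ-* (+ x) (+ p) ⟩
  - + x * + p           ∎))
  where
  open ≡-Reasoning
  rearrange : ∀ m y → m * - y - + 1 ≡ - (+ 1 + y * m)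
  rearrange = solve-∀
... | Bézout.-+ x y 1+xp≡ym = + y , ∣⇒≡-mod (+ m * + y) (+ 1) (ℤˢ.divides (+ x) (begin
  + m * + y - + 1           ≡⟨ cong (_- + 1) (ℤ.*-comm (+ m) (+ y)) ⟩
  + y * + m - + 1           ≡⟨ cong (_- + 1) (pos-1+*≡* x p y m 1+xp≡ym) ⟨
  (+ 1 + + x * + p) - + 1   ≡⟨ cancel (+ 1) (+ x * + p) ⟩
  + x * + p                 ∎))
  where
  open ≡-Reasoning
  cancel : ∀ s t → (s + t) - s ≡ t
  cancel = solve-∀

filter-map : ∀ {a b ℓ} {A : Set a} {B : Set b} {P : Pred B ℓ} (P? : Decidable P) (f : A → B) →
  ∀ xs →
  filter P? (map f xs) ≡ map f (filter (P? ∘ f) xs)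
filter-map P? f []       = refl
filter-map P? f (x ∷ xs) with P? (f x)
... | yes _ = cong (f x ∷_) (filter-map P? f xs)
... | no _  = filter-map P? f xs

_∈Class_ : ℤ → ℕ × ℤ → Set
n ∈Class c = n ≡ proj₂ c [mod proj₁ c ]

Covers : List (ℕ × ℤ) → Set
Covers sys = ∀ n → Any (n ∈Class_) sys

CoversZ⇒Covers : ∀ {sys} → CoversZ sys → Covers sys
CoversZ⇒Covers cov n with i , n∈c ← cov n = lose (∈-lookup i) n∈c

residues : (sys : List (ℕ × ℤ)) → Fin (length (moduli sys)) → ℤ
residues (c ∷ sys) zero    = proj₂ c
residues (c ∷ sys) (suc i) = residues sys i

Covers⇒Coverable : ∀ {sys} → Covers sys → Coverable (moduli sys)
Covers⇒Coverable {sys} cov = residues sys , λ n → located n (cov n)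
  where
  located : ∀ {sys} n → Any (n ∈Class_) sys →
    ∃ λ i → n ≡ residues sys i [mod lookup (moduli sys) i ]
  located n (here n∈c) = zero , n∈c
  located n (there q)  with i , n∈c ← located n q = suc i , n∈c

Coverable⇒Covers : ∀ {ms} → Coverable ms → ∃ λ sys → moduli sys ≡ ms × Covers sys
Coverable⇒Covers {ms} (a , cov) = sys , moduli-sys , covers
  where
  sys : List (ℕ × ℤ)
  sys = tabulate (λ i → lookup ms i , a i)
  moduli-sys : moduli sys ≡ ms
  moduli-sys = trans (map-tabulate _ proj₁) (tabulate-lookup ms)
  covers : Covers sys
  covers n with i , n∈c ← cov n = tabulate⁺ i n∈c

Represents : ℕ → ℤ → ℕ × ℤ → Set
Represents p r c = p ∣ proj₁ c × proj₂ c ≡ r [mod p ]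

represents? : ∀ p r → Decidable (Represents p r)
represents? p r c = (p ∣? proj₁ c) ×-dec (proj₂ c ≡? r [mod p ])

coprimeSubsystem : ℕ → List (ℕ × ℤ) → List (ℕ × ℤ)
coprimeSubsystem p = filter (λ c → ¬? (p ∣? proj₁ c))

moduli-coprimeSubsystem : ∀ sys → moduli (coprimeSubsystem p sys) ≡ coprimePart p (moduli sys)
moduli-coprimeSubsystem sys = sym (filter-map _ proj₁ sys)

coprimeSubsystem-covers : ∀ {r sys} → Prime p → Covers sys →
  ¬ Any (Represents p r) sys → Covers (coprimeSubsystem p sys)
coprimeSubsystem-covers {p} {r} {sys} pp cov r-missed x = covering (find (cov y))
  where
  sub : List (ℕ × ℤ)
  sub = coprimeSubsystem p sys
  N : ℕ
  N = product (moduli sub)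
  p∤N : ¬ p ∣ N
  p∤N = prime∤product pp (All.map⁺ (All.all-filter _ sys))
  inverse : ∃ λ u → (+ N * u) ≡ + 1 [mod p ]
  inverse = coprime⇒inverse (prime∤⇒coprime pp p∤N)
  u : ℤ
  u = proj₁ inverse
  y : ℤ
  y = x + + N * (u * (r - x))
  y≡r : y ≡ r [mod p ]
  y≡r = unit-shift-≡-mod (+ N) u (proj₂ inverse) x r
  covering : (∃ λ c → c ∈ sys × y ∈Class c) → Any (x ∈Class_) sub
  covering (c , c∈sys , y∈c) with p ∣? proj₁ c
  ... | yes p∣m = contradiction
    (lose c∈sys (p∣m , ≡-mod-trans (proj₂ c) y r (≡-mod-sym y (proj₂ c) (∣-trans p∣m y∈c)) y≡r))
    r-missed
  ... | no p∤m  = lose c∈sub (≡-mod-trans x y (proj₂ c) x≡y y∈c)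
    where
    c∈sub : c ∈ sub
    c∈sub = ∈-filter⁺ _ c∈sys p∤m
    x≡y : x ≡ y [mod proj₁ c ]
    x≡y = ≡-mod-sym y x (+-multiple-≡-mod (∈⇒∣product (∈-map⁺ proj₁ c∈sub)) x (u * (r - x)))

AllResiduesRepresented : ℕ → List (ℕ × ℤ) → Set
AllResiduesRepresented p sys = (k : Fin p) → Any (Represents p (+ toℕ k)) sys

missed-residue : ∀ {sys} → ¬ AllResiduesRepresented p sys → ∃ λ r → ¬ Any (Represents p r) sys
missed-residue {p} {sys} ¬all
  with k , ¬any ← Fin.¬∀⟶∃¬ p _ (λ k → Any.any? (represents? p (+ toℕ k)) sys) ¬all
  = + toℕ k , ¬any

coprimePart-coverable : ∀ {sys} → Prime p → Covers sys → ¬ AllResiduesRepresented p sys →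
  Coverable (coprimePart p (moduli sys))
coprimePart-coverable {sys = sys} pp cov ¬all with r , r-missed ← missed-residue ¬all =
  subst Coverable (moduli-coprimeSubsystem sys)
    (Covers⇒Coverable (coprimeSubsystem-covers pp cov r-missed))

AllResiduesRepresented⇒ContainsCRS : ∀ {sys} → Prime p →
  AllResiduesRepresented p sys → ContainsCRS p sys
AllResiduesRepresented⇒ContainsCRS {p} {sys} pp all r =
  i , p∣m , ≡-mod-trans a (+ toℕ k) r a≡k (≡-mod-sym r (+ toℕ k) r≡k)
  where
  instance
    p≢0 : ℕ.NonZero p
    p≢0 = prime⇒nonZero pp
  k : Fin p
  k = fromℕ< (n%ℕd<d r p)
  r≡k : r ≡ (+ toℕ k) [mod p ]
  r≡k = subst (λ j → r ≡ (+ j) [mod p ]) (sym (Fin.toℕ-fromℕ< _)) (≡-mod-%ℕ r p)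
  i : Fin (length sys)
  i = Any.index (all k)
  a : ℤ
  a = proj₂ (lookup sys i)
  p∣m : p ∣ proj₁ (lookup sys i)
  p∣m = proj₁ (lookup-result (all k))
  a≡k : a ≡ (+ toℕ k) [mod p ]
  a≡k = proj₂ (lookup-result (all k))

AllResiduesRepresented⇒p≤countDiv : ∀ {sys} → AllResiduesRepresented p sys →
  p ≤ countDiv p (moduli sys)
AllResiduesRepresented⇒p≤countDiv {p} {sys} all =
  subst (p ≤_) length-div (Fin.injective⇒≤ {f = slot} slot-injective)
  where
  div : List (ℕ × ℤ)
  div = filter (λ c → p ∣? proj₁ c) sys
  length-div : length div ≡ countDiv p (moduli sys)
  length-div = trans (sym (length-map proj₁ div)) (cong length (sym (filter-map _ proj₁ sys)))
  in-div : ∀ k → Any (λ c → proj₂ c ≡ (+ toℕ k) [mod p ]) div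
  in-div k with c , c∈sys , p∣m , a≡k ← find (all k) = lose (∈-filter⁺ _ c∈sys p∣m) a≡k
  slot : Fin p → Fin (length div)
  slot k = Any.index (in-div k)
  slot-injective : Injective _≡_ _≡_ slot
  slot-injective {j} {k} slot-j≡slot-k =
    Fin.toℕ-injective (≡-mod-unique j≡k (Fin.toℕ<n j) (Fin.toℕ<n k))
    where
    a : ℤ
    a = proj₂ (lookup div (slot k))
    a≡j : a ≡ (+ toℕ j) [mod p ]
    a≡j = subst (λ i → proj₂ (lookup div i) ≡ (+ toℕ j) [mod p ]) slot-j≡slot-k
      (lookup-result (in-div j))
    j≡k : (+ toℕ j) ≡ (+ toℕ k) [mod p ]
    j≡k = ≡-mod-trans (+ toℕ j) a (+ toℕ k)
      (≡-mod-sym a (+ toℕ j) a≡j) (lookup-result (in-div k))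

lemma4 : (p : ℕ) → Prime p →
    ((sys : List (ℕ × ℤ)) → AllPositive (moduli sys) → CoversZ sys →
      ¬ ContainsCRS p sys → Coverable (coprimePart p (moduli sys)))
    × ((ms : List ℕ) → AllPositive ms → Coverable ms →
      countDiv p ms < p → Coverable (coprimePart p ms))
lemma4 p pp = part₁ , part₂
  where
  part₁ : (sys : List (ℕ × ℤ)) → AllPositive (moduli sys) → CoversZ sys →
    ¬ ContainsCRS p sys → Coverable (coprimePart p (moduli sys))
  part₁ sys _ cov ¬crs =
    coprimePart-coverable pp (CoversZ⇒Covers cov)
      (¬crs ∘ AllResiduesRepresented⇒ContainsCRS {sys = sys} pp)
  part₂ : (ms : List ℕ) → AllPositive ms → Coverable ms →
    countDiv p ms < p → Coverable (coprimePart p ms)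
  part₂ ms _ coverable few with sys , refl , cov ← Coverable⇒Covers {ms} coverable =
    coprimePart-coverable pp cov (ℕ.<⇒≱ few ∘ AllResiduesRepresented⇒p≤countDiv)
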